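{- Let $n$ be a power of $2$. The minimum of $H_{\min}(X)$ over all $n$-tuples $X=(X_1,\dots,X_n)$ of $3$-wise independent unbiased binary random variables equals $\log(2n)$.
   Context: A binary random variable is unbiased if it takes values $0$ and $1$ each with probability $1/2$. $X_1,\dots,X_n$ are $3$-wise independent if for every $S\subseteq[n]$ with $|S|\le 3$ the variables $(X_i)_{i\in S}$ are mutually independent (for $n\ge3$ equivalently for all $|S|=3$). $H_{\min}(X)=\min_x\log\frac{1}{\Pr[X=x]}$ (minimum over $x$ in the support) is the min-entropy; logarithms are base $2$.
   Formalization: The joint distribution of every $n$-tuple $X=(X_1,\dots,X_n)$ takes rational values. -}

module Defs where

open import Data.Nat using (ℕ; zero; suc; _^_)
open import Data.Bool using (Bool; true; false; if_then_else_; _∧_; T)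
open import Data.Integer using (+_)
open import Data.Rational using (ℚ; 0ℚ; 1ℚ; ½; _+_; _*_; _≤_; _/_)
open import Data.Vec using (Vec; []; _∷_; lookup)
open import Data.Fin using (Fin)
open import Data.Fin.Subset using (Subset; ∣_∣)
open import Data.List using (List; []; _∷_; map; _++_; foldr)
open import Data.List using (allFin) renaming ([_] to [_]ₗ)
open import Data.Product using (_×_; ∃)
open import Relation.Binary.PropositionalEquality using (_≡_)
open import Relation.Nullary using (¬_)

-- Outcomes of n binary random variables: bit vectors of length n.
-- A joint distribution of (X_1,...,X_n) is a function p : Vec Bool n → ℚ.

allBits : (n : ℕ) → List (Vec Bool n)
allBits zero = [ [] ]ₗ
allBits (suc n) = map (false ∷_) (allBits n) ++ map (true ∷_) (allBits n)

sumℚ : List ℚ → ℚ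
sumℚ = foldr _+_ 0ℚ

prodℚ : List ℚ → ℚ
prodℚ = foldr _*_ 1ℚ

_==ᵇ_ : Bool → Bool → Bool
false ==ᵇ false = true
true  ==ᵇ true  = true
_     ==ᵇ _     = false

Pr : {n : ℕ} → (Vec Bool n → ℚ) → (Vec Bool n → Bool) → ℚ
Pr {n} p E = sumℚ (map (λ x → if E x then p x else 0ℚ) (allBits n))

IsDistribution : {n : ℕ} → (Vec Bool n → ℚ) → Set
IsDistribution {n} p = (∀ x → 0ℚ ≤ p x) × sumℚ (map p (allBits n)) ≡ 1ℚ

Unbiased : {n : ℕ} → (Vec Bool n → ℚ) → Set
Unbiased {n} p = ∀ (i : Fin n) (v : Bool) → Pr p (λ x → lookup x i ==ᵇ v) ≡ ½

agreeOn : {n : ℕ} → Subset n → Vec Bool n → Vec Bool n → Bool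
agreeOn [] [] [] = true
agreeOn (s ∷ S) (b ∷ bs) (x ∷ xs) = (if s then (b ==ᵇ x) else true) ∧ agreeOn S bs xs

members : {n : ℕ} → Subset n → List (Fin n)
members {n} S = keep (allFin n)
  where
  keep : List (Fin n) → List (Fin n)
  keep [] = []
  keep (i ∷ is) = if lookup S i then i ∷ keep is else keep is

MutuallyIndependentOn : {n : ℕ} → (Vec Bool n → ℚ) → Subset n → Set
MutuallyIndependentOn {n} p S =
  ∀ (b : Vec Bool n) →
    Pr p (agreeOn S b) ≡ prodℚ (map (λ i → Pr p (λ x → lookup x i ==ᵇ lookup b i)) (members S))

ThreeWiseIndependent : {n : ℕ} → (Vec Bool n → ℚ) → Set
ThreeWiseIndependent {n} p = ∀ (S : Subset n) → ∣ S ∣ Data.Nat.≤ 3 → MutuallyIndependentOn p S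

ℕ→ℚ : ℕ → ℚ
ℕ→ℚ m = + m / 1

-- H_min(p) ≥ log m   ⇔   every outcome in the support has probability ≤ 1/m
-- (outcomes with p x = 0 satisfy p x * m ≤ 1 trivially)
HminAtLeastLog : {n : ℕ} → (Vec Bool n → ℚ) → ℕ → Set
HminAtLeastLog p m = ∀ x → p x * ℕ→ℚ m ≤ 1ℚ

-- H_min(p) = log m   ⇔   max_x p x = 1/m
HminEqualsLog : {n : ℕ} → (Vec Bool n → ℚ) → ℕ → Set
HminEqualsLog p m = HminAtLeastLog p m × ∃ λ x → p x * ℕ→ℚ m ≡ 1ℚ

Admissible : {n : ℕ} → (Vec Bool n → ℚ) → Set
Admissible p = IsDistribution p × ThreeWiseIndependent p × Unbiased p

{-# OPTIONS --safe #-}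

-- Fix an outcome x and a coordinate o, and let s_j(y) = ±1 according as y_j agrees
-- with x_j or not. For 3-wise independent unbiased bits E[[y_o = x_o] s_j s_k] = δ_jk / 2, so the
-- nonnegative function q(y) = [y_o = x_o] (Σ_j s_j(y))² has expectation n/2, whereas q(x) = n².
-- Hence Pr[X = x] n² ≤ n/2, i.e. Pr[X = x] ≤ 1/(2n).
--
-- The first-order Reed–Muller code C_k ⊆ {0,1}^(2^k), obtained from C_0 = {0, 1} by
-- u ↦ (u, u), (u, ū), has 2n words, and every character (-1)^⟨T,·⟩ with 1 ≤ |T| ≤ 3 sums to zero
-- over it. Expanding agreement indicators in characters, any ≤ 3 coordinates of a uniformly chosen
-- codeword are uniform, and every codeword has probability exactly 1/(2n).

module Submission where

module ThreeWiseIndependence where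

  open import Defs
  open import Algebra.Bundles using (CommutativeRing; CommutativeMonoid)
  import Algebra.Solver.Ring.AlmostCommutativeRing as ACR
  import Algebra.Solver.Ring.Simple as RingSolver
  open import Data.Bool using (Bool; true; false; if_then_else_; _∧_; _∨_; not; _xor_)
  import Data.Bool.Properties as Bool
  open import Data.Fin using (Fin; zero; suc)
  open import Data.Fin.Properties using (_≟_)
  open import Data.Fin.Subset using (Subset; ∣_∣; ⁅_⁆; _∪_; ⊥)
  open import Data.Fin.Subset.Properties using (∣⁅x⁆∣≡1; ∣⊥∣≡0; ∪-identityˡ)
  import Data.Integer as ℤ
  import Data.Integer.Properties as ℤ
  open import Data.List using (List; []; _∷_; map; _++_; length; tabulate; allFin)
  import Data.List.Properties as List
  open import Data.List.Membership.Propositional using (_∈_)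
  open import Data.List.Relation.Unary.Any using (here; there)
  open import Data.Nat as ℕ using (ℕ; zero; suc; z≤n; s≤s)
  import Data.Nat.Properties as ℕ
  open import Data.Product using (_,_; proj₁; ∃₂)
  open import Data.Rational using (ℚ; 0ℚ; 1ℚ; ½; -_; _+_; _*_; _≤_; toℚᵘ; nonNegative; Positive)
  import Data.Rational as ℚ using (∣_∣)
  import Data.Rational.Properties as ℚ
  open import Data.Rational.Solver using (module +-*-Solver)
  open import Data.Rational.Unnormalised as ℚᵘ using (mkℚᵘ; *≡*)
  import Data.Rational.Unnormalised.Properties as ℚᵘ
  open import Data.Sum using (inj₁; inj₂)
  open import Data.Unit using (tt)
  open import Data.Vec using (Vec; []; _∷_; lookup; replicate; zipWith) renaming (_++_ to _++ᵥ_)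
  import Data.Vec as Vec using (splitAt)
  import Data.Vec.Properties as Vec
  open import Function using (_∘_; id)
  open import Relation.Binary.PropositionalEquality
  open import Relation.Nullary.Decidable using (does; yes; no; dec-true)
  open import Relation.Nullary.Negation using (contradiction)

  open +-*-Solver using (solve; _:+_; _:*_; :-_; _:=_; con)
  module BoolRingSolver = RingSolver (ACR.fromCommutativeRing Bool.xor-∧-commutativeRing) Bool._≟_
  open BoolRingSolver using ()
    renaming (solve to solveᵇ; _:+_ to _:xor_; _:*_ to _:∧_; _:=_ to _:=ᵇ_)
  open import Algebra.Properties.CommutativeSemigroup
    (CommutativeMonoid.commutativeSemigroup Bool.∧-commutativeMonoid)
    using () renaming (interchange to ∧-interchange)
  open CommutativeRing ℚ.+-*-commutativeRing using (semiring; commutativeSemiring)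
  open import Algebra.Properties.Semiring.Sum semiring
    using (sum; sum-syntax; sum-cong-≗; sum-replicate; sum-replicate-zero; *-distribˡ-sum; *-distribʳ-sum)
  open import Algebra.Properties.Semiring.Mult semiring using (_×_; ×-homo-+; ×-assoc-*)
  open import Algebra.Properties.CommutativeSemiring.Exp commutativeSemiring using (_^_)

  private variable
    A B : Set
    m n : ℕ

  sumOver : List A → (A → ℚ) → ℚ
  sumOver L f = sumℚ (map f L)

  infixl 10 sumOver
  syntax sumOver L (λ x → e) = ∑[ x ∈ L ] e

  ∑-cong : ∀ (L : List A) {f g : A → ℚ} → (∀ x → f x ≡ g x) → ∑[ x ∈ L ] f x ≡ ∑[ x ∈ L ] g x
  ∑-cong [] f≗g = refl
  ∑-cong (x ∷ L) f≗g = cong₂ _+_ (f≗g x) (∑-cong L f≗g)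

  ∑-zero : ∀ (L : List A) {f : A → ℚ} → (∀ x → f x ≡ 0ℚ) → ∑[ x ∈ L ] f x ≡ 0ℚ
  ∑-zero [] f≗0 = refl
  ∑-zero (x ∷ L) f≗0 = cong₂ _+_ (f≗0 x) (∑-zero L f≗0)

  ∑-distrib-+ : ∀ (L : List A) (f g : A → ℚ) →
                ∑[ x ∈ L ] (f x + g x) ≡ ∑[ x ∈ L ] f x + ∑[ x ∈ L ] g x
  ∑-distrib-+ [] f g = refl
  ∑-distrib-+ (x ∷ L) f g = trans (cong (f x + g x +_) (∑-distrib-+ L f g))
    (solve 4 (λ a b c d → (a :+ b) :+ (c :+ d) := (a :+ c) :+ (b :+ d))
             refl (f x) (g x) (∑[ x ∈ L ] f x) (∑[ x ∈ L ] g x))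

  *-distribˡ-∑ : ∀ (L : List A) c (f : A → ℚ) → c * ∑[ x ∈ L ] f x ≡ ∑[ x ∈ L ] (c * f x)
  *-distribˡ-∑ [] c f = ℚ.*-zeroʳ c
  *-distribˡ-∑ (x ∷ L) c f = trans (ℚ.*-distribˡ-+ c (f x) _) (cong (c * f x +_) (*-distribˡ-∑ L c f))

  *-distribʳ-∑ : ∀ (L : List A) c (f : A → ℚ) → ∑[ x ∈ L ] f x * c ≡ ∑[ x ∈ L ] (f x * c)
  *-distribʳ-∑ L c f =
    trans (ℚ.*-comm _ c) (trans (*-distribˡ-∑ L c f) (∑-cong L (λ x → ℚ.*-comm c (f x))))

  ∑-++ : ∀ (L M : List A) (f : A → ℚ) → ∑[ x ∈ L ++ M ] f x ≡ ∑[ x ∈ L ] f x + ∑[ x ∈ M ] f x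
  ∑-++ [] M f = sym (ℚ.+-identityˡ _)
  ∑-++ (x ∷ L) M f = trans (cong (f x +_) (∑-++ L M f)) (sym (ℚ.+-assoc (f x) _ _))

  ∑-map : ∀ (g : B → A) (L : List B) (f : A → ℚ) → ∑[ x ∈ map g L ] f x ≡ ∑[ y ∈ L ] f (g y)
  ∑-map g [] f = refl
  ∑-map g (y ∷ L) f = cong (f (g y) +_) (∑-map g L f)

  ∑-mono-≤ : ∀ (L : List A) {f g : A → ℚ} → (∀ x → f x ≤ g x) → ∑[ x ∈ L ] f x ≤ ∑[ x ∈ L ] g x
  ∑-mono-≤ [] f≤g = ℚ.≤-refl
  ∑-mono-≤ (x ∷ L) f≤g = ℚ.+-mono-≤ (f≤g x) (∑-mono-≤ L f≤g)

  ∑-nonNeg : ∀ (L : List A) {f : A → ℚ} → (∀ x → 0ℚ ≤ f x) → 0ℚ ≤ ∑[ x ∈ L ] f x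
  ∑-nonNeg [] f≥0 = ℚ.≤-refl
  ∑-nonNeg (x ∷ L) f≥0 = ℚ.+-mono-≤ (f≥0 x) (∑-nonNeg L f≥0)

  ∑-comm : ∀ (L : List A) (M : List B) (f : A → B → ℚ) →
           ∑[ x ∈ L ] ∑[ y ∈ M ] f x y ≡ ∑[ y ∈ M ] ∑[ x ∈ L ] f x y
  ∑-comm [] M f = sym (∑-zero M (λ _ → refl))
  ∑-comm (x ∷ L) M f = trans (cong (∑[ y ∈ M ] f x y +_) (∑-comm L M f))
    (sym (∑-distrib-+ M (f x) (λ y → ∑[ x ∈ L ] f x y)))

  ∑-comm-sum : ∀ (L : List A) (f : A → Fin n → ℚ) →
               ∑[ x ∈ L ] ∑[ i < n ] f x i ≡ ∑[ i < n ] ∑[ x ∈ L ] f x i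
  ∑-comm-sum {n = zero} L f = ∑-zero L (λ _ → refl)
  ∑-comm-sum {n = suc n} L f = trans (∑-distrib-+ L (λ x → f x zero) (λ x → ∑[ i < n ] f x (suc i)))
    (cong (∑[ x ∈ L ] f x zero +_) (∑-comm-sum L (λ x i → f x (suc i))))

  *-nonNeg : ∀ {a b} → 0ℚ ≤ a → 0ℚ ≤ b → 0ℚ ≤ a * b
  *-nonNeg {a} {b} 0≤a 0≤b =
    subst (_≤ a * b) (ℚ.*-zeroʳ a) (ℚ.*-monoˡ-≤-nonNeg a {{nonNegative 0≤a}} 0≤b)

  square-nonNeg : ∀ a → 0ℚ ≤ a * a
  square-nonNeg a = subst (0ℚ ≤_) ∣a∣*∣a∣≡a*a (*-nonNeg (ℚ.0≤∣p∣ a) (ℚ.0≤∣p∣ a))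
    where
    ∣a∣*∣a∣≡a*a : ℚ.∣ a ∣ * ℚ.∣ a ∣ ≡ a * a
    ∣a∣*∣a∣≡a*a with ℚ.∣p∣≡p∨∣p∣≡-p a
    ... | inj₁ ∣a∣≡a = cong₂ _*_ ∣a∣≡a ∣a∣≡a
    ... | inj₂ ∣a∣≡-a = trans (cong₂ _*_ ∣a∣≡-a ∣a∣≡-a) (solve 1 (λ a → (:- a) :* (:- a) := a :* a) refl a)

  ℕ→ℚ-suc : ∀ m → ℕ→ℚ (suc m) ≡ 1ℚ + ℕ→ℚ m
  ℕ→ℚ-suc m = ℚ.toℚᵘ-injective (begin-equality
    toℚᵘ (ℕ→ℚ (suc m))              ≃⟨ ℚ.toℚᵘ-fromℚᵘ (mkℚᵘ (+ suc m) 0) ⟩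
    mkℚᵘ (+ suc m) 0                ≃⟨ *≡* numerators ⟩
    mkℚᵘ (+ 1) 0 ℚᵘ.+ mkℚᵘ (+ m) 0  ≃⟨ ℚᵘ.+-congʳ _ (ℚᵘ.≃-sym (ℚ.toℚᵘ-fromℚᵘ (mkℚᵘ (+ m) 0))) ⟩
    toℚᵘ 1ℚ ℚᵘ.+ toℚᵘ (ℕ→ℚ m)       ≃⟨ ℚ.toℚᵘ-homo-+ 1ℚ (ℕ→ℚ m) ⟨
    toℚᵘ (1ℚ + ℕ→ℚ m)               ∎)
    where
    open ℚᵘ.≤-Reasoning
    open import Data.Integer using (+_)
    numerators : + suc m ℤ.* + 1 ≡ (+ 1 ℤ.+ + m ℤ.* + 1) ℤ.* + 1
    numerators = trans (ℤ.*-identityʳ _)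
      (sym (trans (ℤ.*-identityʳ _) (cong (λ z → + 1 ℤ.+ z) (ℤ.*-identityʳ (+ m)))))

  ℕ→ℚ≡×1 : ∀ m → ℕ→ℚ m ≡ m × 1ℚ
  ℕ→ℚ≡×1 zero = refl
  ℕ→ℚ≡×1 (suc m) = trans (ℕ→ℚ-suc m) (cong (1ℚ +_) (ℕ→ℚ≡×1 m))

  ℕ→ℚ-double : ∀ m → ℕ→ℚ (2 ℕ.* m) ≡ ℕ→ℚ m + ℕ→ℚ m
  ℕ→ℚ-double m = begin
    ℕ→ℚ (m ℕ.+ (m ℕ.+ 0))   ≡⟨ cong (λ k → ℕ→ℚ (m ℕ.+ k)) (ℕ.+-identityʳ m) ⟩
    ℕ→ℚ (m ℕ.+ m)           ≡⟨ ℕ→ℚ≡×1 (m ℕ.+ m) ⟩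
    (m ℕ.+ m) × 1ℚ          ≡⟨ ×-homo-+ 1ℚ m m ⟩
    m × 1ℚ + m × 1ℚ         ≡⟨ cong₂ _+_ (ℕ→ℚ≡×1 m) (ℕ→ℚ≡×1 m) ⟨
    ℕ→ℚ m + ℕ→ℚ m           ∎
    where open ≡-Reasoning

  half-bound : ∀ a N .{{_ : Positive N}} → a * (N * N) ≤ N * ½ → a * (N + N) ≤ 1ℚ
  half-bound a N aN²≤N/2 = ℚ.*-cancelʳ-≤-pos N (begin
    a * (N + N) * N             ≡⟨ solve 2 (λ a N → a :* (N :+ N) :* N := a :* (N :* N) :+ a :* (N :* N))
                                           refl a N ⟩
    a * (N * N) + a * (N * N)   ≤⟨ ℚ.+-mono-≤ aN²≤N/2 aN²≤N/2 ⟩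
    N * ½ + N * ½               ≡⟨ solve 1 (λ N → N :* con ½ :+ N :* con ½ := con 1ℚ :* N) refl N ⟩
    1ℚ * N                      ∎)
    where open ℚ.≤-Reasoning

  sum-const : ∀ n c → ∑[ i < n ] c ≡ ℕ→ℚ n * c
  sum-const n c = begin
    ∑[ i < n ] c    ≡⟨ sum-replicate n ⟩
    n × c           ≡⟨ cong (n ×_) (ℚ.*-identityˡ c) ⟨
    n × (1ℚ * c)    ≡⟨ ×-assoc-* n 1ℚ c ⟨
    n × 1ℚ * c      ≡⟨ cong (_* c) (ℕ→ℚ≡×1 n) ⟨
    ℕ→ℚ n * c       ∎
    where open ≡-Reasoning

  sum-if-≟ : ∀ (j : Fin n) c → ∑[ k < n ] (if does (j ≟ k) then c else 0ℚ) ≡ c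
  sum-if-≟ {suc n} zero c = trans (cong (c +_) (sum-replicate-zero n)) (ℚ.+-identityʳ c)
  sum-if-≟ {suc n} (suc j) c =
    trans (ℚ.+-identityˡ (∑[ k < n ] (if does (j ≟ k) then c else 0ℚ))) (sum-if-≟ j c)

  *-square-sum : ∀ a (f : Fin n → ℚ) → a * (sum f * sum f) ≡ ∑[ j < n ] ∑[ k < n ] (a * (f j * f k))
  *-square-sum {n} a f = begin
    a * (sum f * sum f)                      ≡⟨ cong (a *_) (*-distribʳ-sum (sum f) f) ⟩
    a * ∑[ j < n ] (f j * sum f)             ≡⟨ *-distribˡ-sum a (λ j → f j * sum f) ⟩
    ∑[ j < n ] (a * (f j * sum f))           ≡⟨ sum-cong-≗ (λ j → cong (a *_) (*-distribˡ-sum (f j) f)) ⟩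
    ∑[ j < n ] (a * ∑[ k < n ] (f j * f k))  ≡⟨ sum-cong-≗ (λ j → *-distribˡ-sum a (λ k → f j * f k)) ⟩
    ∑[ j < n ] ∑[ k < n ] (a * (f j * f k))  ∎
    where open ≡-Reasoning

  𝟙 : Bool → ℚ
  𝟙 true = 1ℚ
  𝟙 false = 0ℚ

  𝟙-∧ : ∀ a b → 𝟙 (a ∧ b) ≡ 𝟙 a * 𝟙 b
  𝟙-∧ true b = sym (ℚ.*-identityˡ (𝟙 b))
  𝟙-∧ false b = sym (ℚ.*-zeroˡ (𝟙 b))

  𝟙-nonNeg : ∀ b → 0ℚ ≤ 𝟙 b
  𝟙-nonNeg true = ℚ.≤ᵇ⇒≤ tt
  𝟙-nonNeg false = ℚ.≤-refl

  *𝟙≤ : ∀ {a} → 0ℚ ≤ a → ∀ b → a * 𝟙 b ≤ a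
  *𝟙≤ {a} 0≤a true = ℚ.≤-reflexive (ℚ.*-identityʳ a)
  *𝟙≤ {a} 0≤a false = subst (_≤ a) (sym (ℚ.*-zeroʳ a)) 0≤a

  if-else-0≡*𝟙 : ∀ b q → (if b then q else 0ℚ) ≡ q * 𝟙 b
  if-else-0≡*𝟙 true q = sym (ℚ.*-identityʳ q)
  if-else-0≡*𝟙 false q = sym (ℚ.*-zeroʳ q)

  sign : Bool → ℚ
  sign false = 1ℚ
  sign true = - 1ℚ

  sign-xor : ∀ a b → sign (a xor b) ≡ sign a * sign b
  sign-xor false false = refl
  sign-xor false true = refl
  sign-xor true false = refl
  sign-xor true true = refl

  ±1 : Bool → ℚ
  ±1 b = sign (not b)

  𝔼 : (Vec Bool n → ℚ) → (Vec Bool n → ℚ) → ℚ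
  𝔼 {n} p f = ∑[ y ∈ allBits n ] (p y * f y)

  Pr≡𝔼𝟙 : ∀ (p : Vec Bool n → ℚ) A → Pr p A ≡ 𝔼 p (𝟙 ∘ A)
  Pr≡𝔼𝟙 {n} p A = ∑-cong (allBits n) (λ y → if-else-0≡*𝟙 (A y) (p y))

  module _ (p : Vec Bool n → ℚ) where

    𝔼-cong : ∀ {f g} → (∀ y → f y ≡ g y) → 𝔼 p f ≡ 𝔼 p g
    𝔼-cong f≗g = ∑-cong (allBits n) (λ y → cong (p y *_) (f≗g y))

    𝔼-+ : ∀ f g → 𝔼 p (λ y → f y + g y) ≡ 𝔼 p f + 𝔼 p g
    𝔼-+ f g = trans (∑-cong (allBits n) (λ y → ℚ.*-distribˡ-+ (p y) (f y) (g y)))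
                    (∑-distrib-+ (allBits n) (λ y → p y * f y) (λ y → p y * g y))

    𝔼-* : ∀ c f → 𝔼 p (λ y → c * f y) ≡ c * 𝔼 p f
    𝔼-* c f = trans (∑-cong (allBits n) (λ y → swap-factors (p y) c (f y)))
                    (sym (*-distribˡ-∑ (allBits n) c (λ y → p y * f y)))
      where
      swap-factors : ∀ a b c → a * (b * c) ≡ b * (a * c)
      swap-factors = solve 3 (λ a b c → a :* (b :* c) := b :* (a :* c)) refl

    𝔼-sum : ∀ (f : Fin m → Vec Bool n → ℚ) → 𝔼 p (λ y → ∑[ i < m ] f i y) ≡ ∑[ i < m ] 𝔼 p (f i)
    𝔼-sum f = trans (∑-cong (allBits n) (λ y → *-distribˡ-sum (p y) (λ i → f i y)))
                    (∑-comm-sum (allBits n) (λ y i → p y * f i y))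

  ∑-allBits-suc : ∀ (f : Vec Bool (suc n) → ℚ) →
                  ∑[ y ∈ allBits (suc n) ] f y ≡ ∑[ y ∈ allBits n ] f (false ∷ y) + ∑[ y ∈ allBits n ] f (true ∷ y)
  ∑-allBits-suc {n} f = trans (∑-++ (map (false ∷_) (allBits n)) _ f)
                              (cong₂ _+_ (∑-map (false ∷_) (allBits n) f) (∑-map (true ∷_) (allBits n) f))

  _==ᵥ_ : Vec Bool n → Vec Bool n → Bool
  u ==ᵥ v = does (Vec.≡-dec Bool._≟_ u v)

  ∑-allBits-select : ∀ (f : Vec Bool n → ℚ) c → ∑[ y ∈ allBits n ] (f y * 𝟙 (y ==ᵥ c)) ≡ f c
  ∑-allBits-select {zero} f [] = trans (ℚ.+-identityʳ (f [] * 1ℚ)) (ℚ.*-identityʳ (f []))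
  ∑-allBits-select {suc n} f (false ∷ c) = begin
    ∑[ y ∈ allBits (suc n) ] (f y * 𝟙 (y ==ᵥ (false ∷ c)))
      ≡⟨ ∑-allBits-suc (λ y → f y * 𝟙 (y ==ᵥ (false ∷ c))) ⟩
    ∑[ y ∈ allBits n ] (f (false ∷ y) * 𝟙 (y ==ᵥ c)) + ∑[ y ∈ allBits n ] (f (true ∷ y) * 0ℚ)
      ≡⟨ cong₂ _+_ (∑-allBits-select (f ∘ (false ∷_)) c) (∑-zero (allBits n) (λ y → ℚ.*-zeroʳ (f (true ∷ y)))) ⟩
    f (false ∷ c) + 0ℚ
      ≡⟨ ℚ.+-identityʳ (f (false ∷ c)) ⟩
    f (false ∷ c)
      ∎
    where open ≡-Reasoning
  ∑-allBits-select {suc n} f (true ∷ c) = begin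
    ∑[ y ∈ allBits (suc n) ] (f y * 𝟙 (y ==ᵥ (true ∷ c)))
      ≡⟨ ∑-allBits-suc (λ y → f y * 𝟙 (y ==ᵥ (true ∷ c))) ⟩
    ∑[ y ∈ allBits n ] (f (false ∷ y) * 0ℚ) + ∑[ y ∈ allBits n ] (f (true ∷ y) * 𝟙 (y ==ᵥ c))
      ≡⟨ cong₂ _+_ (∑-zero (allBits n) (λ y → ℚ.*-zeroʳ (f (false ∷ y)))) (∑-allBits-select (f ∘ (true ∷_)) c) ⟩
    0ℚ + f (true ∷ c)
      ≡⟨ ℚ.+-identityˡ (f (true ∷ c)) ⟩
    f (true ∷ c)
      ∎
    where open ≡-Reasoning

  ≤-∑-allBits : ∀ (f : Vec Bool n → ℚ) → (∀ y → 0ℚ ≤ f y) → ∀ x → f x ≤ ∑[ y ∈ allBits n ] f y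
  ≤-∑-allBits {n} f f≥0 x =
    subst (_≤ _) (∑-allBits-select f x) (∑-mono-≤ (allBits n) (λ y → *𝟙≤ (f≥0 y) (y ==ᵥ x)))

  ==ᵇ-comm : ∀ a b → (a ==ᵇ b) ≡ (b ==ᵇ a)
  ==ᵇ-comm false false = refl
  ==ᵇ-comm false true = refl
  ==ᵇ-comm true false = refl
  ==ᵇ-comm true true = refl

  ==ᵇ-refl : ∀ a → (a ==ᵇ a) ≡ true
  ==ᵇ-refl false = refl
  ==ᵇ-refl true = refl

  if-∨-else-true : ∀ u v e → (if u ∨ v then e else true) ≡ (if u then e else true) ∧ (if v then e else true)
  if-∨-else-true true true e = sym (Bool.∧-idem e)
  if-∨-else-true true false e = sym (Bool.∧-identityʳ e)
  if-∨-else-true false v e = refl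

  agreeOn-⊥ : ∀ (b y : Vec Bool n) → agreeOn ⊥ b y ≡ true
  agreeOn-⊥ [] [] = refl
  agreeOn-⊥ (_ ∷ b) (_ ∷ y) = agreeOn-⊥ b y

  agreeOn-⁅⁆ : ∀ (i : Fin n) b y → agreeOn ⁅ i ⁆ b y ≡ (lookup b i ==ᵇ lookup y i)
  agreeOn-⁅⁆ zero (β ∷ b) (γ ∷ y) = trans (cong ((β ==ᵇ γ) ∧_) (agreeOn-⊥ b y)) (Bool.∧-identityʳ (β ==ᵇ γ))
  agreeOn-⁅⁆ (suc i) (_ ∷ b) (_ ∷ y) = agreeOn-⁅⁆ i b y

  agreeOn-∪ : ∀ (U V : Subset n) b y → agreeOn (U ∪ V) b y ≡ agreeOn U b y ∧ agreeOn V b y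
  agreeOn-∪ [] [] [] [] = refl
  agreeOn-∪ (u ∷ U) (v ∷ V) (β ∷ b) (γ ∷ y) =
    trans (cong₂ _∧_ (if-∨-else-true u v (β ==ᵇ γ)) (agreeOn-∪ U V b y))
          (∧-interchange (if u then β ==ᵇ γ else true) _ _ _)

  lookup-⁅⁆ : ∀ (i j : Fin n) → lookup ⁅ j ⁆ i ≡ does (i ≟ j)
  lookup-⁅⁆ zero zero = refl
  lookup-⁅⁆ zero (suc j) = refl
  lookup-⁅⁆ (suc i) zero = Vec.lookup-replicate i false
  lookup-⁅⁆ (suc i) (suc j) = lookup-⁅⁆ i j

  ∣⁅i⁆∪p∣ : ∀ (i : Fin n) p → ∣ ⁅ i ⁆ ∪ p ∣ ≡ (if lookup p i then ∣ p ∣ else suc ∣ p ∣)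
  ∣⁅i⁆∪p∣ zero (true ∷ p) = cong (suc ∘ ∣_∣) (∪-identityˡ p)
  ∣⁅i⁆∪p∣ zero (false ∷ p) = cong (suc ∘ ∣_∣) (∪-identityˡ p)
  ∣⁅i⁆∪p∣ (suc i) (true ∷ p) = trans (cong suc (∣⁅i⁆∪p∣ i p)) (Bool.if-float suc (lookup p i))
  ∣⁅i⁆∪p∣ (suc i) (false ∷ p) = ∣⁅i⁆∪p∣ i p

  distinct₂ : Bool → ℕ
  distinct₂ i≡j = if i≡j then 1 else 2

  distinct₃ : Bool → Bool → Bool → ℕ
  distinct₃ i≡j i≡k j≡k = if i≡j ∨ i≡k then distinct₂ j≡k else suc (distinct₂ j≡k)

  distinct₂≤2 : ∀ u → distinct₂ u ℕ.≤ 2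
  distinct₂≤2 true = s≤s z≤n
  distinct₂≤2 false = ℕ.≤-refl

  distinct₃≤3 : ∀ u v w → distinct₃ u v w ℕ.≤ 3
  distinct₃≤3 u v w with u ∨ v
  ... | true = ℕ.m≤n⇒m≤1+n (distinct₂≤2 w)
  ... | false = s≤s (distinct₂≤2 w)

  ∣⁅i,j⁆∣ : ∀ (i j : Fin n) → ∣ ⁅ i ⁆ ∪ ⁅ j ⁆ ∣ ≡ distinct₂ (does (i ≟ j))
  ∣⁅i,j⁆∣ i j =
    trans (∣⁅i⁆∪p∣ i ⁅ j ⁆) (cong₂ (λ t c → if t then c else suc c) (lookup-⁅⁆ i j) (∣⁅x⁆∣≡1 j))

  ∣⁅i,j,k⁆∣ : ∀ (i j k : Fin n) →
              ∣ ⁅ i ⁆ ∪ (⁅ j ⁆ ∪ ⁅ k ⁆) ∣ ≡ distinct₃ (does (i ≟ j)) (does (i ≟ k)) (does (j ≟ k))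
  ∣⁅i,j,k⁆∣ i j k =
    trans (∣⁅i⁆∪p∣ i (⁅ j ⁆ ∪ ⁅ k ⁆)) (cong₂ (λ t c → if t then c else suc c) i∈⁅j⁆∪⁅k⁆ (∣⁅i,j⁆∣ j k))
    where
    i∈⁅j⁆∪⁅k⁆ : lookup (⁅ j ⁆ ∪ ⁅ k ⁆) i ≡ does (i ≟ j) ∨ does (i ≟ k)
    i∈⁅j⁆∪⁅k⁆ = trans (Vec.lookup-zipWith _∨_ i ⁅ j ⁆ ⁅ k ⁆) (cong₂ _∨_ (lookup-⁅⁆ i j) (lookup-⁅⁆ i k))

  ThreeWiseUniform : (Vec Bool n → ℚ) → Set
  ThreeWiseUniform {n} p = ∀ (S : Subset n) b → ∣ S ∣ ℕ.≤ 3 → Pr p (agreeOn S b) ≡ ½ ^ ∣ S ∣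

  -- Defs computes `members S` with a local filter that cannot be named here; generalising `allFin n`
  -- in `members≡filterSubset` lets unification instantiate `F` in `filterSubset-unique` with it.
  filterSubset : Subset n → List (Fin n) → List (Fin n)
  filterSubset S [] = []
  filterSubset S (i ∷ is) = if lookup S i then i ∷ filterSubset S is else filterSubset S is

  filterSubset-unique : ∀ (S : Subset n) (F : List (Fin n) → List (Fin n)) → F [] ≡ [] →
                        (∀ i is → F (i ∷ is) ≡ (if lookup S i then i ∷ F is else F is)) →
                        ∀ is → F is ≡ filterSubset S is
  filterSubset-unique S F F[] F∷ [] = F[]
  filterSubset-unique S F F[] F∷ (i ∷ is) rewrite F∷ i is | filterSubset-unique S F F[] F∷ is = refl

  members≡filterSubset : ∀ (S : Subset n) → members S ≡ filterSubset S (allFin n)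
  members≡filterSubset {n} S with allFin n | filterSubset-unique S _ refl (λ _ _ → refl)
  ... | is | F≗filterSubset = F≗filterSubset is

  filterSubset-map-suc : ∀ s (S : Subset n) is →
                         filterSubset (s ∷ S) (map suc is) ≡ map suc (filterSubset S is)
  filterSubset-map-suc s S [] = refl
  filterSubset-map-suc s S (i ∷ is) with lookup S i
  ... | true = cong (suc i ∷_) (filterSubset-map-suc s S is)
  ... | false = filterSubset-map-suc s S is

  length-members : ∀ (S : Subset n) → length (members S) ≡ ∣ S ∣
  length-members S = trans (cong length (members≡filterSubset S)) (length-filterSubset S)
    where
    length-filterSubset : ∀ {n} (S : Subset n) → length (filterSubset S (allFin n)) ≡ ∣ S ∣
    length-filterSubset-suc : ∀ {n} s (S : Subset n) → length (filterSubset (s ∷ S) (tabulate suc)) ≡ ∣ S ∣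
    length-filterSubset [] = refl
    length-filterSubset (true ∷ S) = cong suc (length-filterSubset-suc true S)
    length-filterSubset (false ∷ S) = length-filterSubset-suc false S
    length-filterSubset-suc {n} s S = begin
      length (filterSubset (s ∷ S) (tabulate suc))
        ≡⟨ cong (length ∘ filterSubset (s ∷ S)) (List.map-tabulate id suc) ⟨
      length (filterSubset (s ∷ S) (map suc (allFin n)))
        ≡⟨ cong length (filterSubset-map-suc s S (allFin n)) ⟩
      length (map suc (filterSubset S (allFin n)))
        ≡⟨ List.length-map (suc {n}) (filterSubset S (allFin n)) ⟩
      length (filterSubset S (allFin n))
        ≡⟨ length-filterSubset S ⟩
      ∣ S ∣
        ∎
      where open ≡-Reasoning

  prod-members-½ : ∀ (g : Fin n → ℚ) → (∀ i → g i ≡ ½) → ∀ S → prodℚ (map g (members S)) ≡ ½ ^ ∣ S ∣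
  prod-members-½ g g≗½ S = trans (prod-½ (members S)) (cong (½ ^_) (length-members S))
    where
    prod-½ : ∀ is → prodℚ (map g is) ≡ ½ ^ length is
    prod-½ [] = refl
    prod-½ (i ∷ is) = cong₂ _*_ (g≗½ i) (prod-½ is)

  admissible⇒threeWiseUniform : ∀ {p : Vec Bool n → ℚ} → Admissible p → ThreeWiseUniform p
  admissible⇒threeWiseUniform (_ , independent , unbiased) S b ∣S∣≤3 =
    trans (independent S ∣S∣≤3 b) (prod-members-½ _ (λ i → unbiased i (lookup b i)) S)

  threeWiseUniform⇒admissible : ∀ {p : Vec Bool n → ℚ} → IsDistribution p → ThreeWiseUniform p → Admissible p
  threeWiseUniform⇒admissible {n} {p} distribution uniform = distribution , independent , unbiased
    where
    unbiased : Unbiased p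
    unbiased i v = begin
      Pr p (λ y → lookup y i ==ᵇ v)         ≡⟨ ∑-cong (allBits n) (λ y → cong (λ t → if t then p y else 0ℚ) (agrees y)) ⟩
      Pr p (agreeOn ⁅ i ⁆ (replicate n v))  ≡⟨ uniform ⁅ i ⁆ _ (ℕ.≤-trans (ℕ.≤-reflexive (∣⁅x⁆∣≡1 i)) (s≤s z≤n)) ⟩
      ½ ^ ∣ ⁅ i ⁆ ∣                         ≡⟨ cong (½ ^_) (∣⁅x⁆∣≡1 i) ⟩
      ½ * 1ℚ                                ≡⟨ ℚ.*-identityʳ ½ ⟩
      ½                                     ∎
      where
      open ≡-Reasoning
      agrees : ∀ y → (lookup y i ==ᵇ v) ≡ agreeOn ⁅ i ⁆ (replicate n v) y
      agrees y = sym (trans (agreeOn-⁅⁆ i _ y)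
                            (trans (cong (_==ᵇ lookup y i) (Vec.lookup-replicate i v)) (==ᵇ-comm v (lookup y i))))
    independent : ThreeWiseIndependent p
    independent S ∣S∣≤3 b =
      trans (uniform S b ∣S∣≤3) (sym (prod-members-½ _ (λ i → unbiased i (lookup b i)) S))

  -- The lower bound

  -- Expands ±1 b = 2 𝟙 b - 1 and uses 𝟙 b * 𝟙 b = 𝟙 b.
  𝟙*±1*±1 : ∀ a b c → 𝟙 a * (±1 b * ±1 c) ≡
            ℕ→ℚ 4 * (𝟙 a * (𝟙 b * 𝟙 c)) + (- ℕ→ℚ 2 * (𝟙 a * 𝟙 b) + (- ℕ→ℚ 2 * (𝟙 a * 𝟙 c) + 𝟙 a))
  𝟙*±1*±1 true true true = refl
  𝟙*±1*±1 true true false = refl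
  𝟙*±1*±1 true false true = refl
  𝟙*±1*±1 true false false = refl
  𝟙*±1*±1 false true true = refl
  𝟙*±1*±1 false true false = refl
  𝟙*±1*±1 false false true = refl
  𝟙*±1*±1 false false false = refl

  orthogonality-table : ∀ (i j k : Fin n) →
    ℕ→ℚ 4 * ½ ^ distinct₃ (does (i ≟ j)) (does (i ≟ k)) (does (j ≟ k))
      + (- ℕ→ℚ 2 * ½ ^ distinct₂ (does (i ≟ j)) + (- ℕ→ℚ 2 * ½ ^ distinct₂ (does (i ≟ k)) + ½))
    ≡ (if does (j ≟ k) then ½ else 0ℚ)
  orthogonality-table i j k with i ≟ j | i ≟ k | j ≟ k
  ... | yes _    | yes _    | yes _    = refl
  ... | yes refl | yes refl | no j≢k   = contradiction refl j≢k
  ... | yes refl | no i≢k   | yes refl = contradiction refl i≢k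
  ... | yes _    | no _     | no _     = refl
  ... | no i≢j   | yes refl | yes refl = contradiction refl i≢j
  ... | no _     | yes _    | no _     = refl
  ... | no _     | no _     | yes _    = refl
  ... | no _     | no _     | no _     = refl

  module LowerBound {n} (p : Vec Bool n → ℚ) (p≥0 : ∀ y → 0ℚ ≤ p y) (p-uniform : ThreeWiseUniform p)
                    (x : Vec Bool n) where

    agrees : Fin n → Vec Bool n → Bool
    agrees i y = lookup x i ==ᵇ lookup y i

    e s : Fin n → Vec Bool n → ℚ
    e i y = 𝟙 (agrees i y)
    s i y = ±1 (agrees i y)

    𝔼-agreeOn : ∀ S {c} → ∣ S ∣ ≡ c → c ℕ.≤ 3 → 𝔼 p (𝟙 ∘ agreeOn S x) ≡ ½ ^ c
    𝔼-agreeOn S refl c≤3 = trans (sym (Pr≡𝔼𝟙 p (agreeOn S x))) (p-uniform S x c≤3)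

    𝔼-e : ∀ i → 𝔼 p (e i) ≡ ½
    𝔼-e i = trans (𝔼-cong p (λ y → cong 𝟙 (sym (agreeOn-⁅⁆ i x y))))
                  (𝔼-agreeOn ⁅ i ⁆ (∣⁅x⁆∣≡1 i) (s≤s z≤n))

    𝔼-ee : ∀ i j → 𝔼 p (λ y → e i y * e j y) ≡ ½ ^ distinct₂ (does (i ≟ j))
    𝔼-ee i j = trans (𝔼-cong p ee≡𝟙agreeOn)
      (𝔼-agreeOn (⁅ i ⁆ ∪ ⁅ j ⁆) (∣⁅i,j⁆∣ i j) (ℕ.m≤n⇒m≤1+n (distinct₂≤2 (does (i ≟ j)))))
      where
      ee≡𝟙agreeOn : ∀ y → e i y * e j y ≡ 𝟙 (agreeOn (⁅ i ⁆ ∪ ⁅ j ⁆) x y)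
      ee≡𝟙agreeOn y = sym (begin
        𝟙 (agreeOn (⁅ i ⁆ ∪ ⁅ j ⁆) x y)            ≡⟨ cong 𝟙 (agreeOn-∪ ⁅ i ⁆ ⁅ j ⁆ x y) ⟩
        𝟙 (agreeOn ⁅ i ⁆ x y ∧ agreeOn ⁅ j ⁆ x y)  ≡⟨ cong₂ (λ a b → 𝟙 (a ∧ b)) (agreeOn-⁅⁆ i x y) (agreeOn-⁅⁆ j x y) ⟩
        𝟙 (agrees i y ∧ agrees j y)                ≡⟨ 𝟙-∧ (agrees i y) (agrees j y) ⟩
        e i y * e j y                              ∎)
        where open ≡-Reasoning

    𝔼-eee : ∀ i j k → 𝔼 p (λ y → e i y * (e j y * e k y))
                      ≡ ½ ^ distinct₃ (does (i ≟ j)) (does (i ≟ k)) (does (j ≟ k))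
    𝔼-eee i j k = trans (𝔼-cong p eee≡𝟙agreeOn)
      (𝔼-agreeOn (⁅ i ⁆ ∪ (⁅ j ⁆ ∪ ⁅ k ⁆)) (∣⁅i,j,k⁆∣ i j k)
                 (distinct₃≤3 (does (i ≟ j)) (does (i ≟ k)) (does (j ≟ k))))
      where
      eee≡𝟙agreeOn : ∀ y → e i y * (e j y * e k y) ≡ 𝟙 (agreeOn (⁅ i ⁆ ∪ (⁅ j ⁆ ∪ ⁅ k ⁆)) x y)
      eee≡𝟙agreeOn y = sym (begin
        𝟙 (agreeOn (⁅ i ⁆ ∪ (⁅ j ⁆ ∪ ⁅ k ⁆)) x y)
          ≡⟨ cong 𝟙 (trans (agreeOn-∪ ⁅ i ⁆ _ x y) (cong (agreeOn ⁅ i ⁆ x y ∧_) (agreeOn-∪ ⁅ j ⁆ ⁅ k ⁆ x y))) ⟩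
        𝟙 (agreeOn ⁅ i ⁆ x y ∧ (agreeOn ⁅ j ⁆ x y ∧ agreeOn ⁅ k ⁆ x y))
          ≡⟨ cong₂ (λ a b → 𝟙 (a ∧ b)) (agreeOn-⁅⁆ i x y) (cong₂ _∧_ (agreeOn-⁅⁆ j x y) (agreeOn-⁅⁆ k x y)) ⟩
        𝟙 (agrees i y ∧ (agrees j y ∧ agrees k y))
          ≡⟨ trans (𝟙-∧ (agrees i y) _) (cong (e i y *_) (𝟙-∧ (agrees j y) (agrees k y))) ⟩
        e i y * (e j y * e k y)
          ∎)
        where open ≡-Reasoning

    orthogonality : ∀ o j k → 𝔼 p (λ y → e o y * (s j y * s k y)) ≡ (if does (j ≟ k) then ½ else 0ℚ)
    orthogonality o j k = begin
      𝔼 p (λ y → e o y * (s j y * s k y))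
        ≡⟨ 𝔼-cong p (λ y → 𝟙*±1*±1 (agrees o y) (agrees j y) (agrees k y)) ⟩
      𝔼 p (λ y → ℕ→ℚ 4 * eee y + (- ℕ→ℚ 2 * ee y + (- ℕ→ℚ 2 * ee′ y + e o y)))
        ≡⟨ trans (𝔼-+ p _ _) (cong₂ _+_ (𝔼-* p (ℕ→ℚ 4) eee)
             (trans (𝔼-+ p _ _) (cong₂ _+_ (𝔼-* p (- ℕ→ℚ 2) ee)
               (trans (𝔼-+ p _ _) (cong (_+ 𝔼 p (e o)) (𝔼-* p (- ℕ→ℚ 2) ee′)))))) ⟩
      ℕ→ℚ 4 * 𝔼 p eee + (- ℕ→ℚ 2 * 𝔼 p ee + (- ℕ→ℚ 2 * 𝔼 p ee′ + 𝔼 p (e o)))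
        ≡⟨ cong₂ (λ a b → ℕ→ℚ 4 * a + b) (𝔼-eee o j k)
             (cong₂ (λ a b → - ℕ→ℚ 2 * a + b) (𝔼-ee o j) (cong₂ (λ a b → - ℕ→ℚ 2 * a + b) (𝔼-ee o k) (𝔼-e o))) ⟩
      ℕ→ℚ 4 * ½ ^ distinct₃ (does (o ≟ j)) (does (o ≟ k)) (does (j ≟ k))
        + (- ℕ→ℚ 2 * ½ ^ distinct₂ (does (o ≟ j)) + (- ℕ→ℚ 2 * ½ ^ distinct₂ (does (o ≟ k)) + ½))
        ≡⟨ orthogonality-table o j k ⟩
      (if does (j ≟ k) then ½ else 0ℚ)
        ∎
      where
      open ≡-Reasoning
      eee ee ee′ : Vec Bool n → ℚ
      eee y = e o y * (e j y * e k y)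
      ee y = e o y * e j y
      ee′ y = e o y * e k y

    Z : Vec Bool n → ℚ
    Z y = ∑[ j < n ] s j y

    𝔼-e*Z² : ∀ o → 𝔼 p (λ y → e o y * (Z y * Z y)) ≡ ℕ→ℚ n * ½
    𝔼-e*Z² o = begin
      𝔼 p (λ y → e o y * (Z y * Z y))               ≡⟨ 𝔼-cong p (λ y → *-square-sum (e o y) (λ j → s j y)) ⟩
      𝔼 p (λ y → ∑[ j < n ] ∑[ k < n ] term j k y)   ≡⟨ 𝔼-sum p (λ j y → ∑[ k < n ] term j k y) ⟩
      ∑[ j < n ] 𝔼 p (λ y → ∑[ k < n ] term j k y)   ≡⟨ sum-cong-≗ (λ j → 𝔼-sum p (term j)) ⟩
      ∑[ j < n ] ∑[ k < n ] 𝔼 p (term j k)           ≡⟨ sum-cong-≗ (λ j → trans (sum-cong-≗ (orthogonality o j))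
                                                                                (sum-if-≟ j ½)) ⟩
      ∑[ j < n ] ½                                   ≡⟨ sum-const n ½ ⟩
      ℕ→ℚ n * ½                                      ∎
      where
      open ≡-Reasoning
      term : Fin n → Fin n → Vec Bool n → ℚ
      term j k y = e o y * (s j y * s k y)

    p[x]*n²≤n/2 : Fin n → p x * (ℕ→ℚ n * ℕ→ℚ n) ≤ ℕ→ℚ n * ½
    p[x]*n²≤n/2 o = subst₂ _≤_ at-x (𝔼-e*Z² o) (≤-∑-allBits _ nonNeg x)
      where
      nonNeg : ∀ y → 0ℚ ≤ p y * (e o y * (Z y * Z y))
      nonNeg y = *-nonNeg (p≥0 y) (*-nonNeg (𝟙-nonNeg (agrees o y)) (square-nonNeg (Z y)))
      Z[x] : Z x ≡ ℕ→ℚ n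
      Z[x] = trans (sum-cong-≗ (λ j → cong ±1 (==ᵇ-refl (lookup x j))))
                   (trans (sum-const n 1ℚ) (ℚ.*-identityʳ (ℕ→ℚ n)))
      at-x : p x * (e o x * (Z x * Z x)) ≡ p x * (ℕ→ℚ n * ℕ→ℚ n)
      at-x = cong (p x *_) (trans (cong (λ t → 𝟙 t * (Z x * Z x)) (==ᵇ-refl (lookup x o)))
                                  (trans (ℚ.*-identityˡ (Z x * Z x)) (cong₂ _*_ Z[x] Z[x])))

  admissible⇒HminAtLeastLog : ∀ {n} (p : Vec Bool n → ℚ) → Admissible p → HminAtLeastLog p (2 ℕ.* n)
  admissible⇒HminAtLeastLog {zero} p _ x = ℚ.≤-trans (ℚ.≤-reflexive (ℚ.*-zeroʳ (p x))) (𝟙-nonNeg true)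
  admissible⇒HminAtLeastLog {suc n} p admissible x =
    subst (λ N → p x * N ≤ 1ℚ) (sym (ℕ→ℚ-double (suc n)))
          (half-bound (p x) (ℕ→ℚ (suc n)) {{ℚ.normalize-pos (suc n) 1}} (p[x]*n²≤n/2 zero))
    where open LowerBound p (proj₁ (proj₁ admissible)) (admissible⇒threeWiseUniform admissible) x

  -- Characters of {0,1}ᵐ and the Fourier expansion of agreement

  𝟙-==ᵇ : ∀ a b → 𝟙 (a ==ᵇ b) ≡ ½ * (1ℚ + sign a * sign b)
  𝟙-==ᵇ false false = refl
  𝟙-==ᵇ false true = refl
  𝟙-==ᵇ true false = refl
  𝟙-==ᵇ true true = refl

  infix 7 _·_
  _·_ : Vec Bool m → Vec Bool m → Bool
  [] · [] = false
  (t ∷ T) · (c ∷ cs) = (t ∧ c) xor (T · cs)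

  χ : Subset m → Vec Bool m → ℚ
  χ T c = sign (T · c)

  ∣T∣≡0⇒T·c≡false : ∀ (T : Subset m) → ∣ T ∣ ≡ 0 → ∀ c → T · c ≡ false
  ∣T∣≡0⇒T·c≡false [] _ [] = refl
  ∣T∣≡0⇒T·c≡false (false ∷ T) ∣T∣≡0 (_ ∷ c) = ∣T∣≡0⇒T·c≡false T ∣T∣≡0 c

  ⊥·c≡false : ∀ (c : Vec Bool m) → ⊥ · c ≡ false
  ⊥·c≡false {m} = ∣T∣≡0⇒T·c≡false ⊥ (∣⊥∣≡0 m)

  subsets : Subset m → List (Subset m)
  subsets [] = [] ∷ []
  subsets (false ∷ S) = map (false ∷_) (subsets S)
  subsets (true ∷ S) = map (false ∷_) (subsets S) ++ map (true ∷_) (subsets S)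

  𝟙-agreeOn : ∀ (S : Subset m) b c → 𝟙 (agreeOn S b c) ≡ ½ ^ ∣ S ∣ * ∑[ T ∈ subsets S ] (χ T b * χ T c)
  𝟙-agreeOn [] [] [] = refl
  𝟙-agreeOn (false ∷ S) (β ∷ b) (γ ∷ c) =
    trans (𝟙-agreeOn S b c) (cong (½ ^ ∣ S ∣ *_) (sym (∑-map (false ∷_) (subsets S) _)))
  𝟙-agreeOn (true ∷ S) (β ∷ b) (γ ∷ c) = begin
    𝟙 ((β ==ᵇ γ) ∧ agreeOn S b c)
      ≡⟨ 𝟙-∧ (β ==ᵇ γ) (agreeOn S b c) ⟩
    𝟙 (β ==ᵇ γ) * 𝟙 (agreeOn S b c)
      ≡⟨ cong₂ _*_ (𝟙-==ᵇ β γ) (𝟙-agreeOn S b c) ⟩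
    ½ * (1ℚ + σ) * (½ ^ ∣ S ∣ * Σ)
      ≡⟨ solve 4 (λ h σ w Σ → h :* (con 1ℚ :+ σ) :* (w :* Σ) := h :* w :* (Σ :+ σ :* Σ)) refl ½ σ (½ ^ ∣ S ∣) Σ ⟩
    ½ ^ suc ∣ S ∣ * (Σ + σ * Σ)
      ≡⟨ cong (λ t → ½ ^ suc ∣ S ∣ * (Σ + t))
              (trans (*-distribˡ-∑ (subsets S) σ (λ T → χ T b * χ T c)) (∑-cong (subsets S) σ*χχ≡χχ)) ⟩
    ½ ^ suc ∣ S ∣ * (Σ + ∑[ T ∈ subsets S ] (χ (true ∷ T) (β ∷ b) * χ (true ∷ T) (γ ∷ c)))
      ≡⟨ cong (½ ^ suc ∣ S ∣ *_) (sym (trans (∑-++ (map (false ∷_) (subsets S)) _ _)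
                                              (cong₂ _+_ (∑-map (false ∷_) (subsets S) _) (∑-map (true ∷_) (subsets S) _)))) ⟩
    ½ ^ suc ∣ S ∣ * ∑[ T ∈ subsets (true ∷ S) ] (χ T (β ∷ b) * χ T (γ ∷ c))
      ∎
    where
    open ≡-Reasoning
    σ Σ : ℚ
    σ = sign β * sign γ
    Σ = ∑[ T ∈ subsets S ] (χ T b * χ T c)
    σ*χχ≡χχ : ∀ T → σ * (χ T b * χ T c) ≡ χ (true ∷ T) (β ∷ b) * χ (true ∷ T) (γ ∷ c)
    σ*χχ≡χχ T = sym (trans (cong₂ _*_ (sign-xor β (T · b)) (sign-xor γ (T · c)))
                           (solve 4 (λ a b c d → a :* c :* (b :* d) := a :* b :* (c :* d))
                                    refl (sign β) (sign γ) (χ T b) (χ T c)))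

  ∑-subsets : ∀ (S : Subset m) (g : Subset m → ℚ) →
              (∀ T → 1 ℕ.≤ ∣ T ∣ → ∣ T ∣ ℕ.≤ ∣ S ∣ → g T ≡ 0ℚ) → ∑[ T ∈ subsets S ] g T ≡ g ⊥
  ∑-subsets [] g _ = ℚ.+-identityʳ (g [])
  ∑-subsets (false ∷ S) g g≡0 =
    trans (∑-map (false ∷_) (subsets S) g) (∑-subsets S (g ∘ (false ∷_)) (λ T → g≡0 (false ∷ T)))
  ∑-subsets {suc m} (true ∷ S) g g≡0 = begin
    ∑[ T ∈ subsets (true ∷ S) ] g T
      ≡⟨ ∑-++ (map (false ∷_) (subsets S)) _ g ⟩
    ∑[ T ∈ map (false ∷_) (subsets S) ] g T + ∑[ T ∈ map (true ∷_) (subsets S) ] g T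
      ≡⟨ cong₂ _+_ (∑-map (false ∷_) (subsets S) g) (∑-map (true ∷_) (subsets S) g) ⟩
    ∑[ T ∈ subsets S ] g (false ∷ T) + ∑[ T ∈ subsets S ] g (true ∷ T)
      ≡⟨ cong₂ _+_
           (∑-subsets S (g ∘ (false ∷_)) (λ T 1≤∣T∣ ∣T∣≤∣S∣ → g≡0 (false ∷ T) 1≤∣T∣ (ℕ.m≤n⇒m≤1+n ∣T∣≤∣S∣)))
           (∑-subsets S (g ∘ (true ∷_)) (λ T _ ∣T∣≤∣S∣ → g≡0 (true ∷ T) (s≤s z≤n) (s≤s ∣T∣≤∣S∣))) ⟩
    g (false ∷ ⊥) + g (true ∷ ⊥)
      ≡⟨ cong (g ⊥ +_) (g≡0 (true ∷ ⊥) (s≤s z≤n) (s≤s (ℕ.≤-trans (ℕ.≤-reflexive (∣⊥∣≡0 m)) z≤n))) ⟩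
    g ⊥ + 0ℚ
      ≡⟨ ℚ.+-identityʳ (g ⊥) ⟩
    g ⊥
      ∎
    where open ≡-Reasoning

  count : (Vec Bool m → Bool) → List (Vec Bool m) → ℚ
  count A C = ∑[ c ∈ C ] 𝟙 (A c)

  size : List (Vec Bool m) → ℚ
  size C = ∑[ c ∈ C ] 1ℚ

  bias : List (Vec Bool m) → Subset m → ℚ
  bias C T = ∑[ c ∈ C ] χ T c

  Balanced₃ : List (Vec Bool m) → Set
  Balanced₃ {m} C = ∀ (T : Subset m) → 1 ℕ.≤ ∣ T ∣ → ∣ T ∣ ℕ.≤ 3 → bias C T ≡ 0ℚ

  count-agreeOn : ∀ (S : Subset m) b C →
                  count (agreeOn S b) C ≡ ½ ^ ∣ S ∣ * ∑[ T ∈ subsets S ] (χ T b * bias C T)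
  count-agreeOn S b C = begin
    ∑[ c ∈ C ] 𝟙 (agreeOn S b c)
      ≡⟨ ∑-cong C (𝟙-agreeOn S b) ⟩
    ∑[ c ∈ C ] (½ ^ ∣ S ∣ * ∑[ T ∈ subsets S ] (χ T b * χ T c))
      ≡⟨ *-distribˡ-∑ C (½ ^ ∣ S ∣) _ ⟨
    ½ ^ ∣ S ∣ * ∑[ c ∈ C ] ∑[ T ∈ subsets S ] (χ T b * χ T c)
      ≡⟨ cong (½ ^ ∣ S ∣ *_) (∑-comm C (subsets S) _) ⟩
    ½ ^ ∣ S ∣ * ∑[ T ∈ subsets S ] ∑[ c ∈ C ] (χ T b * χ T c)
      ≡⟨ cong (½ ^ ∣ S ∣ *_) (∑-cong (subsets S) (λ T → *-distribˡ-∑ C (χ T b) (χ T))) ⟨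
    ½ ^ ∣ S ∣ * ∑[ T ∈ subsets S ] (χ T b * bias C T)
      ∎
    where open ≡-Reasoning

  count-agreeOn-balanced : ∀ {C : List (Vec Bool m)} → Balanced₃ C → ∀ S b → ∣ S ∣ ℕ.≤ 3 →
                           count (agreeOn S b) C ≡ ½ ^ ∣ S ∣ * size C
  count-agreeOn-balanced {C = C} balanced S b ∣S∣≤3 = trans (count-agreeOn S b C)
    (cong (½ ^ ∣ S ∣ *_) (trans (∑-subsets S (λ T → χ T b * bias C T) vanish) trivial-character))
    where
    vanish : ∀ T → 1 ℕ.≤ ∣ T ∣ → ∣ T ∣ ℕ.≤ ∣ S ∣ → χ T b * bias C T ≡ 0ℚ
    vanish T 1≤∣T∣ ∣T∣≤∣S∣ =
      trans (cong (χ T b *_) (balanced T 1≤∣T∣ (ℕ.≤-trans ∣T∣≤∣S∣ ∣S∣≤3))) (ℚ.*-zeroʳ (χ T b))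
    trivial-character : χ ⊥ b * bias C ⊥ ≡ size C
    trivial-character = trans (cong (_* bias C ⊥) (cong sign (⊥·c≡false b)))
                              (trans (ℚ.*-identityˡ (bias C ⊥)) (∑-cong C (λ c → cong sign (⊥·c≡false c))))

  multiplicity : Vec Bool m → List (Vec Bool m) → ℚ
  multiplicity y C = ∑[ c ∈ C ] 𝟙 (y ==ᵥ c)

  1≤multiplicity : ∀ {c : Vec Bool m} {C} → c ∈ C → 1ℚ ≤ multiplicity c C
  1≤multiplicity {c = c} {C = c ∷ C} (here refl) =
    subst (λ t → 1ℚ + 0ℚ ≤ 𝟙 t + multiplicity c C) (sym (dec-true (Vec.≡-dec Bool._≟_ c c) refl))
          (ℚ.+-monoʳ-≤ 1ℚ (∑-nonNeg C (λ c′ → 𝟙-nonNeg (c ==ᵥ c′))))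
  1≤multiplicity {c = c} {C = c′ ∷ C} (there c∈C) =
    subst (_≤ 𝟙 (c ==ᵥ c′) + multiplicity c C) (ℚ.+-identityˡ 1ℚ)
          (ℚ.+-mono-≤ (𝟙-nonNeg (c ==ᵥ c′)) (1≤multiplicity c∈C))

  uniformOn : List (Vec Bool m) → ℚ → Vec Bool m → ℚ
  uniformOn C w y = w * multiplicity y C

  module _ (C : List (Vec Bool m)) (w : ℚ) where

    𝔼-uniformOn : ∀ f → 𝔼 (uniformOn C w) f ≡ w * ∑[ c ∈ C ] f c
    𝔼-uniformOn f = begin
      ∑[ y ∈ allBits m ] (w * multiplicity y C * f y)
        ≡⟨ ∑-cong (allBits m) (λ y → ℚ.*-assoc w (multiplicity y C) (f y)) ⟩
      ∑[ y ∈ allBits m ] (w * (multiplicity y C * f y))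
        ≡⟨ *-distribˡ-∑ (allBits m) w (λ y → multiplicity y C * f y) ⟨
      w * ∑[ y ∈ allBits m ] (multiplicity y C * f y)
        ≡⟨ cong (w *_) (∑-cong (allBits m) (λ y → *-distribʳ-∑ C (f y) (λ c → 𝟙 (y ==ᵥ c)))) ⟩
      w * ∑[ y ∈ allBits m ] ∑[ c ∈ C ] (𝟙 (y ==ᵥ c) * f y)
        ≡⟨ cong (w *_) (∑-comm (allBits m) C (λ y c → 𝟙 (y ==ᵥ c) * f y)) ⟩
      w * ∑[ c ∈ C ] ∑[ y ∈ allBits m ] (𝟙 (y ==ᵥ c) * f y)
        ≡⟨ cong (w *_) (∑-cong C (λ c → trans (∑-cong (allBits m) (λ y → ℚ.*-comm (𝟙 (y ==ᵥ c)) (f y)))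
                                              (∑-allBits-select f c))) ⟩
      w * ∑[ c ∈ C ] f c
        ∎
      where open ≡-Reasoning

    uniformOn-isDistribution : 0ℚ ≤ w → w * size C ≡ 1ℚ → IsDistribution (uniformOn C w)
    uniformOn-isDistribution 0≤w w*size≡1 =
      (λ y → *-nonNeg 0≤w (∑-nonNeg C (λ c → 𝟙-nonNeg (y ==ᵥ c)))) ,
      trans (∑-cong (allBits m) (λ y → sym (ℚ.*-identityʳ (uniformOn C w y))))
            (trans (𝔼-uniformOn (λ _ → 1ℚ)) w*size≡1)

    uniformOn-threeWiseUniform : w * size C ≡ 1ℚ → Balanced₃ C → ThreeWiseUniform (uniformOn C w)
    uniformOn-threeWiseUniform w*size≡1 balanced S b ∣S∣≤3 = begin
      Pr (uniformOn C w) (agreeOn S b)      ≡⟨ Pr≡𝔼𝟙 (uniformOn C w) (agreeOn S b) ⟩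
      𝔼 (uniformOn C w) (𝟙 ∘ agreeOn S b)   ≡⟨ 𝔼-uniformOn (𝟙 ∘ agreeOn S b) ⟩
      w * count (agreeOn S b) C             ≡⟨ cong (w *_) (count-agreeOn-balanced {C = C} balanced S b ∣S∣≤3) ⟩
      w * (½ ^ ∣ S ∣ * size C)              ≡⟨ solve 3 (λ w h s → w :* (h :* s) := h :* (w :* s)) refl w (½ ^ ∣ S ∣) (size C) ⟩
      ½ ^ ∣ S ∣ * (w * size C)              ≡⟨ cong (½ ^ ∣ S ∣ *_) w*size≡1 ⟩
      ½ ^ ∣ S ∣ * 1ℚ                        ≡⟨ ℚ.*-identityʳ (½ ^ ∣ S ∣) ⟩
      ½ ^ ∣ S ∣                             ∎
      where open ≡-Reasoning

    uniformOn-∈ : 0ℚ ≤ w → ∀ {c} → c ∈ C → w ≤ uniformOn C w c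
    uniformOn-∈ 0≤w {c} c∈C = subst (_≤ uniformOn C w c) (ℚ.*-identityʳ w)
                                    (ℚ.*-monoˡ-≤-nonNeg w {{nonNegative 0≤w}} (1≤multiplicity c∈C))

  -- The extremal code

  _∥_ : Vec A m → Vec A m → Vec A (2 ℕ.* m)
  u ∥ v = u ++ᵥ (v ++ᵥ [])

  ∥-split : ∀ (T : Vec A (2 ℕ.* m)) → ∃₂ λ T₁ T₂ → T ≡ T₁ ∥ T₂
  ∥-split {m = m} T with Vec.splitAt m T
  ... | T₁ , R , refl with Vec.splitAt m R
  ... | T₂ , [] , refl = T₁ , T₂ , refl

  _⊕_ : Vec Bool m → Vec Bool m → Vec Bool m
  _⊕_ = zipWith _xor_

  𝟏 : Vec Bool m
  𝟏 = replicate _ true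

  double : List (Vec Bool m) → List (Vec Bool (2 ℕ.* m))
  double [] = []
  double (c ∷ C) = (c ∥ c) ∷ (c ∥ (c ⊕ 𝟏)) ∷ double C

  code : (k : ℕ) → List (Vec Bool (2 ℕ.^ k))
  code zero = (false ∷ []) ∷ (true ∷ []) ∷ []
  code (suc k) = double (code k)

  ·-++ : ∀ {m₁ m₂} (T₁ c₁ : Vec Bool m₁) (T₂ c₂ : Vec Bool m₂) →
         (T₁ ++ᵥ T₂) · (c₁ ++ᵥ c₂) ≡ (T₁ · c₁) xor (T₂ · c₂)
  ·-++ [] [] T₂ c₂ = refl
  ·-++ (t ∷ T₁) (c ∷ c₁) T₂ c₂ =
    trans (cong ((t ∧ c) xor_) (·-++ T₁ c₁ T₂ c₂)) (sym (Bool.xor-assoc (t ∧ c) (T₁ · c₁) (T₂ · c₂)))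

  ·-∥ : ∀ (T₁ T₂ c₁ c₂ : Vec Bool m) → (T₁ ∥ T₂) · (c₁ ∥ c₂) ≡ (T₁ · c₁) xor (T₂ · c₂)
  ·-∥ T₁ T₂ c₁ c₂ = trans (·-++ T₁ c₁ (T₂ ++ᵥ []) (c₂ ++ᵥ []))
    (cong ((T₁ · c₁) xor_) (trans (·-++ T₂ c₂ [] []) (Bool.xor-identityʳ (T₂ · c₂))))

  ·-⊕ˡ : ∀ (T₁ T₂ c : Vec Bool m) → (T₁ ⊕ T₂) · c ≡ (T₁ · c) xor (T₂ · c)
  ·-⊕ˡ [] [] [] = refl
  ·-⊕ˡ (a ∷ T₁) (b ∷ T₂) (g ∷ c) = trans (cong (((a xor b) ∧ g) xor_) (·-⊕ˡ T₁ T₂ c))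
    (solveᵇ 5 (λ a b g P Q → (a :xor b) :∧ g :xor (P :xor Q) :=ᵇ (a :∧ g :xor P) :xor (b :∧ g :xor Q))
              refl a b g (T₁ · c) (T₂ · c))

  ·-⊕ʳ : ∀ (T c₁ c₂ : Vec Bool m) → T · (c₁ ⊕ c₂) ≡ (T · c₁) xor (T · c₂)
  ·-⊕ʳ [] [] [] = refl
  ·-⊕ʳ (t ∷ T) (g ∷ c₁) (h ∷ c₂) = trans (cong ((t ∧ (g xor h)) xor_) (·-⊕ʳ T c₁ c₂))
    (solveᵇ 5 (λ t g h P Q → t :∧ (g :xor h) :xor (P :xor Q) :=ᵇ (t :∧ g :xor P) :xor (t :∧ h :xor Q))
              refl t g h (T · c₁) (T · c₂))

  bias-double : ∀ (C : List (Vec Bool m)) T₁ T₂ →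
                bias (double C) (T₁ ∥ T₂) ≡ (1ℚ + χ T₂ 𝟏) * bias C (T₁ ⊕ T₂)
  bias-double [] T₁ T₂ = sym (ℚ.*-zeroʳ (1ℚ + χ T₂ 𝟏))
  bias-double (c ∷ C) T₁ T₂ = begin
    χ (T₁ ∥ T₂) (c ∥ c) + (χ (T₁ ∥ T₂) (c ∥ (c ⊕ 𝟏)) + bias (double C) (T₁ ∥ T₂))
      ≡⟨ cong₂ (λ a b → a + (b + bias (double C) (T₁ ∥ T₂))) χ-c∥c χ-c∥c⊕𝟏 ⟩
    χ⊕ + (χ⊕ * χ T₂ 𝟏 + bias (double C) (T₁ ∥ T₂))
      ≡⟨ cong (λ t → χ⊕ + (χ⊕ * χ T₂ 𝟏 + t)) (bias-double C T₁ T₂) ⟩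
    χ⊕ + (χ⊕ * χ T₂ 𝟏 + (1ℚ + χ T₂ 𝟏) * bias C (T₁ ⊕ T₂))
      ≡⟨ solve 3 (λ a o β → a :+ (a :* o :+ (con 1ℚ :+ o) :* β) := (con 1ℚ :+ o) :* (a :+ β))
                 refl χ⊕ (χ T₂ 𝟏) (bias C (T₁ ⊕ T₂)) ⟩
    (1ℚ + χ T₂ 𝟏) * (χ⊕ + bias C (T₁ ⊕ T₂))
      ∎
    where
    open ≡-Reasoning
    χ⊕ : ℚ
    χ⊕ = χ (T₁ ⊕ T₂) c
    χ-c∥c : χ (T₁ ∥ T₂) (c ∥ c) ≡ χ⊕
    χ-c∥c = cong sign (trans (·-∥ T₁ T₂ c c) (sym (·-⊕ˡ T₁ T₂ c)))
    χ-c∥c⊕𝟏 : χ (T₁ ∥ T₂) (c ∥ (c ⊕ 𝟏)) ≡ χ⊕ * χ T₂ 𝟏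
    χ-c∥c⊕𝟏 = trans (cong sign (begin
      (T₁ ∥ T₂) · (c ∥ (c ⊕ 𝟏))             ≡⟨ ·-∥ T₁ T₂ c (c ⊕ 𝟏) ⟩
      (T₁ · c) xor (T₂ · (c ⊕ 𝟏))           ≡⟨ cong ((T₁ · c) xor_) (·-⊕ʳ T₂ c 𝟏) ⟩
      (T₁ · c) xor ((T₂ · c) xor (T₂ · 𝟏))  ≡⟨ Bool.xor-assoc (T₁ · c) (T₂ · c) (T₂ · 𝟏) ⟨
      ((T₁ · c) xor (T₂ · c)) xor (T₂ · 𝟏)  ≡⟨ cong (_xor (T₂ · 𝟏)) (·-⊕ˡ T₁ T₂ c) ⟨
      ((T₁ ⊕ T₂) · c) xor (T₂ · 𝟏)          ∎))
      (sign-xor ((T₁ ⊕ T₂) · c) (T₂ · 𝟏))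

  ∣++∣ : ∀ {m₁ m₂} (T₁ : Subset m₁) (T₂ : Subset m₂) → ∣ T₁ ++ᵥ T₂ ∣ ≡ ∣ T₁ ∣ ℕ.+ ∣ T₂ ∣
  ∣++∣ [] T₂ = refl
  ∣++∣ (true ∷ T₁) T₂ = cong suc (∣++∣ T₁ T₂)
  ∣++∣ (false ∷ T₁) T₂ = ∣++∣ T₁ T₂

  ∣∥∣ : ∀ (T₁ T₂ : Subset m) → ∣ T₁ ∥ T₂ ∣ ≡ ∣ T₁ ∣ ℕ.+ ∣ T₂ ∣
  ∣∥∣ T₁ T₂ = trans (∣++∣ T₁ (T₂ ++ᵥ [])) (cong (∣ T₁ ∣ ℕ.+_) (trans (∣++∣ T₂ []) (ℕ.+-identityʳ ∣ T₂ ∣)))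

  ∣⊕∣≤ : ∀ (T₁ T₂ : Subset m) → ∣ T₁ ⊕ T₂ ∣ ℕ.≤ ∣ T₁ ∣ ℕ.+ ∣ T₂ ∣
  ∣⊕∣≤ [] [] = z≤n
  ∣⊕∣≤ (true ∷ T₁) (true ∷ T₂) =
    ℕ.≤-trans (∣⊕∣≤ T₁ T₂) (ℕ.≤-trans (ℕ.+-monoʳ-≤ ∣ T₁ ∣ (ℕ.n≤1+n ∣ T₂ ∣)) (ℕ.n≤1+n _))
  ∣⊕∣≤ (true ∷ T₁) (false ∷ T₂) = s≤s (∣⊕∣≤ T₁ T₂)
  ∣⊕∣≤ (false ∷ T₁) (true ∷ T₂) = ℕ.≤-trans (s≤s (∣⊕∣≤ T₁ T₂)) (ℕ.≤-reflexive (sym (ℕ.+-suc ∣ T₁ ∣ ∣ T₂ ∣)))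
  ∣⊕∣≤ (false ∷ T₁) (false ∷ T₂) = ∣⊕∣≤ T₁ T₂

  ∣⊕∣≡0⇒≡ : ∀ (T₁ T₂ : Subset m) → ∣ T₁ ⊕ T₂ ∣ ≡ 0 → T₁ ≡ T₂
  ∣⊕∣≡0⇒≡ [] [] _ = refl
  ∣⊕∣≡0⇒≡ (true ∷ T₁) (true ∷ T₂) h = cong (true ∷_) (∣⊕∣≡0⇒≡ T₁ T₂ h)
  ∣⊕∣≡0⇒≡ (false ∷ T₁) (false ∷ T₂) h = cong (false ∷_) (∣⊕∣≡0⇒≡ T₁ T₂ h)

  ∣T∣≡1⇒T·𝟏 : ∀ (T : Subset m) → ∣ T ∣ ≡ 1 → T · 𝟏 ≡ true
  ∣T∣≡1⇒T·𝟏 (true ∷ T) ∣T∣≡1 = cong not (∣T∣≡0⇒T·c≡false T (ℕ.suc-injective ∣T∣≡1) 𝟏)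
  ∣T∣≡1⇒T·𝟏 (false ∷ T) ∣T∣≡1 = ∣T∣≡1⇒T·𝟏 T ∣T∣≡1

  w+w∈[1,3]⇒w≡1 : ∀ w → 1 ℕ.≤ w ℕ.+ w → w ℕ.+ w ℕ.≤ 3 → w ≡ 1
  w+w∈[1,3]⇒w≡1 (suc zero) _ _ = refl
  w+w∈[1,3]⇒w≡1 (suc (suc w)) _ (s≤s (s≤s w+2+w≤1)) with ℕ.≤-trans (ℕ.m≤n+m (suc (suc w)) w) w+2+w≤1
  ... | s≤s ()

  -- If T₁ = T₂, then ∣ T₁ ∥ T₂ ∣ = 2 ∣ T₂ ∣ ∈ [1, 3] forces ∣ T₂ ∣ = 1, so T₂ · 𝟏 would be true.
  1≤∣⊕∣ : ∀ (T₁ T₂ : Subset m) → T₂ · 𝟏 ≡ false →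
          1 ℕ.≤ ∣ T₁ ∥ T₂ ∣ → ∣ T₁ ∥ T₂ ∣ ℕ.≤ 3 → 1 ℕ.≤ ∣ T₁ ⊕ T₂ ∣
  1≤∣⊕∣ T₁ T₂ even 1≤∣T∣ ∣T∣≤3 with ∣ T₁ ⊕ T₂ ∣ in ∣⊕∣≡
  ... | suc _ = s≤s z≤n
  ... | zero with ∣⊕∣≡0⇒≡ T₁ T₂ ∣⊕∣≡
  ... | refl with trans (sym even) (∣T∣≡1⇒T·𝟏 T₂ (w+w∈[1,3]⇒w≡1 ∣ T₂ ∣ (subst (1 ℕ.≤_) (∣∥∣ T₂ T₂) 1≤∣T∣)
                                                                   (subst (ℕ._≤ 3) (∣∥∣ T₂ T₂) ∣T∣≤3)))
  ... | ()

  code-balanced : ∀ k → Balanced₃ (code k)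
  code-balanced zero (true ∷ []) _ _ = refl
  code-balanced (suc k) T 1≤∣T∣ ∣T∣≤3 with ∥-split {m = 2 ℕ.^ k} T
  ... | T₁ , T₂ , refl = trans (bias-double (code k) T₁ T₂) (vanish (T₂ · 𝟏) refl)
    where
    vanish : ∀ b → T₂ · 𝟏 ≡ b → (1ℚ + sign b) * bias (code k) (T₁ ⊕ T₂) ≡ 0ℚ
    vanish true _ = ℚ.*-zeroˡ (bias (code k) (T₁ ⊕ T₂))
    vanish false even =
      trans (cong ((1ℚ + sign false) *_) (code-balanced k (T₁ ⊕ T₂) (1≤∣⊕∣ T₁ T₂ even 1≤∣T∣ ∣T∣≤3) ∣⊕∣≤3))
            (ℚ.*-zeroʳ (1ℚ + sign false))
      where
      ∣⊕∣≤3 : ∣ T₁ ⊕ T₂ ∣ ℕ.≤ 3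
      ∣⊕∣≤3 = ℕ.≤-trans (∣⊕∣≤ T₁ T₂) (subst (ℕ._≤ 3) (∣∥∣ T₁ T₂) ∣T∣≤3)

  size-code : ∀ k → size (code k) ≡ ℕ→ℚ (2 ℕ.* 2 ℕ.^ k)
  size-code zero = refl
  size-code (suc k) =
    trans (size-double (code k)) (trans (cong₂ _+_ (size-code k) (size-code k)) (sym (ℕ→ℚ-double (2 ℕ.* 2 ℕ.^ k))))
    where
    size-double : ∀ {m} (C : List (Vec Bool m)) → size (double C) ≡ size C + size C
    size-double [] = refl
    size-double (c ∷ C) = trans (cong (λ t → 1ℚ + (1ℚ + t)) (size-double C))
      (solve 1 (λ s → con 1ℚ :+ (con 1ℚ :+ (s :+ s)) := (con 1ℚ :+ s) :+ (con 1ℚ :+ s)) refl (size C))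

  weight : ℕ → ℚ
  weight k = ½ ^ suc k

  weight-nonNeg : ∀ k → 0ℚ ≤ weight k
  weight-nonNeg zero = ℚ.≤ᵇ⇒≤ tt
  weight-nonNeg (suc k) = *-nonNeg {½} (ℚ.≤ᵇ⇒≤ tt) (weight-nonNeg k)

  weight*2n≡1 : ∀ k → weight k * ℕ→ℚ (2 ℕ.* 2 ℕ.^ k) ≡ 1ℚ
  weight*2n≡1 zero = refl
  weight*2n≡1 (suc k) = begin
    ½ * weight k * ℕ→ℚ (2 ℕ.* N)        ≡⟨ cong (½ * weight k *_) (ℕ→ℚ-double N) ⟩
    ½ * weight k * (ℕ→ℚ N + ℕ→ℚ N)      ≡⟨ solve 2 (λ w N → con ½ :* w :* (N :+ N) := w :* N) refl (weight k) (ℕ→ℚ N) ⟩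
    weight k * ℕ→ℚ N                    ≡⟨ weight*2n≡1 k ⟩
    1ℚ                                  ∎
    where
    open ≡-Reasoning
    N : ℕ
    N = 2 ℕ.* 2 ℕ.^ k

  extremal : (k : ℕ) → Vec Bool (2 ℕ.^ k) → ℚ
  extremal k = uniformOn (code k) (weight k)

  extremal-admissible : ∀ k → Admissible (extremal k)
  extremal-admissible k = threeWiseUniform⇒admissible
    (uniformOn-isDistribution (code k) (weight k) (weight-nonNeg k) weight*size≡1)
    (uniformOn-threeWiseUniform (code k) (weight k) weight*size≡1 (code-balanced k))
    where
    weight*size≡1 : weight k * size (code k) ≡ 1ℚ
    weight*size≡1 = trans (cong (weight k *_) (size-code k)) (weight*2n≡1 k)

  codeword : (k : ℕ) → Vec Bool (2 ℕ.^ k)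
  codeword zero = false ∷ []
  codeword (suc k) = codeword k ∥ codeword k

  codeword∈code : ∀ k → codeword k ∈ code k
  codeword∈code zero = here refl
  codeword∈code (suc k) = ∈-double (codeword∈code k)
    where
    ∈-double : ∀ {m} {c : Vec Bool m} {C} → c ∈ C → (c ∥ c) ∈ double C
    ∈-double (here refl) = here refl
    ∈-double (there c∈C) = there (there (∈-double c∈C))

  extremal-HminEqualsLog : ∀ k → HminEqualsLog (extremal k) (2 ℕ.* 2 ℕ.^ k)
  extremal-HminEqualsLog k = admissible⇒HminAtLeastLog (extremal k) (extremal-admissible k) , codeword k ,
    ℚ.≤-antisym (admissible⇒HminAtLeastLog (extremal k) (extremal-admissible k) (codeword k)) (begin
      1ℚ                            ≡⟨ weight*2n≡1 k ⟨
      weight k * N                  ≤⟨ ℚ.*-monoʳ-≤-nonNeg N {{ℚ.normalize-nonNeg (2 ℕ.* 2 ℕ.^ k) 1}}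
                                         (uniformOn-∈ (code k) (weight k) (weight-nonNeg k) (codeword∈code k)) ⟩
      extremal k (codeword k) * N   ∎)
    where
    open ℚ.≤-Reasoning
    N : ℚ
    N = ℕ→ℚ (2 ℕ.* 2 ℕ.^ k)

open import Defs
open import Data.Nat using (ℕ; _^_; _*_)
open import Data.Bool using (Bool)
open import Data.Vec using (Vec)
open import Data.Rational using (ℚ)
open import Data.Product using (_×_; ∃; _,_)
open ThreeWiseIndependence
  using (admissible⇒HminAtLeastLog; extremal; extremal-admissible; extremal-HminEqualsLog)

mainTheorem8 : (k : ℕ) →
    ((p : Vec Bool (2 ^ k) → ℚ) → Admissible p → HminAtLeastLog p (2 * 2 ^ k))
    × (∃ λ (p : Vec Bool (2 ^ k) → ℚ) → Admissible p × HminEqualsLog p (2 * 2 ^ k))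
mainTheorem8 k = admissible⇒HminAtLeastLog , (extremal k , extremal-admissible k , extremal-HminEqualsLog k)
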